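{- There is a polynomial $q$ such that for every simple directed graph $G=\langle V,E\rangle$ with $n=\mathrm{card}(V)>0$ vertices the following holds: $G$ is non-Hamiltonian if and only if there exists a normal tree-like natural deduction proof, in intuitionistic propositional logic, of $\alpha_G\rightarrow\bot$ (i.e. of $\lnot\alpha_G$) whose height is at most $q(n)$.
   Context: A simple directed graph $G=\langle V,E\rangle$ has finite vertex set $V$ and edge set $E\subseteq V\times V$, with at most one edge from $v_1$ to $v_2$ for every ordered pair $(v_1,v_2)$ of vertices. Write $[n]=\{1,\dots,n\}$. A Hamiltonian path in $G$ is a sequence of vertices $v_1v_2\ldots v_n$ such that $i\mapsto v_i$ is a bijection of $[n]$ onto $V$ and $(v_i,v_{i+1})\in E$ for every $0<i<n$; $G$ is Hamiltonian iff it has a Hamiltonian path, and non-Hamiltonian otherwise. Formulas are propositional formulas built from propositional variables and the constant $\bot$ using $\wedge,\vee,\rightarrow$, with $\lnot F:=F\rightarrow\bot$. For propositional variables $X_{i,v}$ ($i\in[n]$, $v\in V$) define $A=\bigwedge_{v\in V}(X_{1,v}\vee\cdots\vee X_{n,v})$, $B=\bigwedge_{v\in V}\bigwedge_{i\neq j}(X_{i,v}\rightarrow(X_{j,v}\rightarrow\bot))$ (inner conjunction over ordered pairs $i\neq j$ in $[n]$), $C=\bigwedge_{i\in[n]}\bigvee_{v\in V}X_{i,v}$, $D=\bigwedge_{v\neq w}\bigwedge_{i\in[n]}(X_{i,v}\rightarrow(X_{i,w}\rightarrow\bot))$ (outer conjunction over ordered pairs of distinct vertices), $E'=\bigwedge_{(v,w)\notin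 E}\bigwedge_{i\in[n-1]}(X_{i,v}\rightarrow(X_{i+1,w}\rightarrow\bot))$ (outer conjunction over ordered pairs $(v,w)\in V\times V$ not in $E$), where each iterated $\bigwedge,\bigvee$ denotes an iterated binary conjunction/disjunction over the index set, and let $\alpha_G:=A\wedge B\wedge C\wedge D\wedge E'$. Natural deduction (ND) is the standard Prawitz-style tree-like natural deduction system for intuitionistic propositional logic (introduction and elimination rules for $\wedge,\vee,\rightarrow$ and ex falso for $\bot$); a proof is a deduction with no open (undischarged) assumptions; it is normal if it contains no maximal formula (no formula that is the conclusion of an introduction or of a $\vee$-elimination and the major premise of an elimination); the height is the maximal number of formula occurrences on a branch from the root to a leaf. -}

module Defs where

open import Data.Nat using (ℕ; zero; suc; _+_; _*_; _⊔_; _≤_)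
open import Data.Fin using (Fin; toℕ; _≟_)
open import Data.Bool using (Bool; true; false)
open import Data.List using (List; []; _∷_; concatMap; filter; allFin; map)
open import Data.List.Membership.Propositional using (_∈_)
open import Data.Product using (Σ; _×_; _,_)
open import Data.Unit using (⊤)
open import Relation.Nullary using (¬?)
open import Relation.Binary.PropositionalEquality using (_≡_)
open import Function.Bundles using (_⤖_; Bijection)

-- Simple directed graphs on the vertex set V = Fin n.
-- adj v w ≡ true  iff  (v , w) ∈ E.  (At most one edge per ordered pair
-- is automatic; loops (v,v) are allowed since E ⊆ V × V.)

record Digraph (n : ℕ) : Set where
  field
    adj : Fin n → Fin n → Bool
open Digraph public

-- A Hamiltonian path: a bijection [n] → V (positions i ∈ [n] are
-- represented by Fin n, position k+1 by the element with toℕ = k),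
-- with an edge between consecutive vertices.
Hamiltonian : ∀ {n} → Digraph n → Set
Hamiltonian {n} G =
  Σ (Fin n ⤖ Fin n) λ p →
    ∀ (i j : Fin n) → toℕ j ≡ suc (toℕ i) →
      adj G (Bijection.to p i) (Bijection.to p j) ≡ true

infixr 6 _∧_
infixr 5 _∨_
infixr 4 _⇒_

data Form (At : Set) : Set where
  atom : At → Form At
  ⊥'   : Form At
  _∧_  : Form At → Form At → Form At
  _∨_  : Form At → Form At → Form At
  _⇒_  : Form At → Form At → Form At

module _ {At : Set} where

  ~_ : Form At → Form At
  ~ F = F ⇒ ⊥'

  -- Iterated binary conjunction / disjunction (right nested).
  -- Convention for an empty index set: ⊤ := ⊥ → ⊥ (resp. ⊥).
  ⋀ : List (Form At) → Form At
  ⋀ []           = ⊥' ⇒ ⊥'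
  ⋀ (F ∷ [])     = F
  ⋀ (F ∷ G ∷ Fs) = F ∧ ⋀ (G ∷ Fs)

  ⋁ : List (Form At) → Form At
  ⋁ []           = ⊥'
  ⋁ (F ∷ [])     = F
  ⋁ (F ∷ G ∷ Fs) = F ∨ ⋁ (G ∷ Fs)

Atom : ℕ → Set
Atom n = Fin n × Fin n

module _ {n : ℕ} where

  X : Fin n → Fin n → Form (Atom n)
  X i v = atom (i , v)

  distinctPairs : List (Fin n × Fin n)
  distinctPairs =
    concatMap (λ a → map (λ b → (a , b)) (filter (λ b → ¬? (a ≟ b)) (allFin n)))
              (allFin n)

  consecutive : List (Fin n × Fin n)
  consecutive =
    concatMap (λ i → map (λ j → (i , j))
                 (filter (λ j → toℕ j Data.Nat.≟ suc (toℕ i)) (allFin n)))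
              (allFin n)

  nonEdges : Digraph n → List (Fin n × Fin n)
  nonEdges G =
    concatMap (λ v → map (λ w → (v , w))
                 (filter (λ w → adj G v w Data.Bool.≟ false) (allFin n)))
              (allFin n)

  A-form : Form (Atom n)
  A-form = ⋀ (map (λ v → ⋁ (map (λ i → X i v) (allFin n))) (allFin n))

  B-form : Form (Atom n)
  B-form = ⋀ (map (λ v → ⋀ (map (λ { (i , j) → X i v ⇒ (X j v ⇒ ⊥') }) distinctPairs))
                  (allFin n))

  C-form : Form (Atom n)
  C-form = ⋀ (map (λ i → ⋁ (map (λ v → X i v) (allFin n))) (allFin n))

  D-form : Form (Atom n)
  D-form = ⋀ (map (λ { (v , w) → ⋀ (map (λ i → X i v ⇒ (X i w ⇒ ⊥')) (allFin n)) })
                  distinctPairs)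

  E-form : Digraph n → Form (Atom n)
  E-form G = ⋀ (map (λ { (v , w) →
                   ⋀ (map (λ { (i , j) → X i v ⇒ (X j w ⇒ ⊥') }) consecutive) })
                  (nonEdges G))

  α : Digraph n → Form (Atom n)
  α G = A-form ∧ (B-form ∧ (C-form ∧ (D-form ∧ E-form G)))

-- Open assumptions are recorded in the list Γ; the
-- leaf  ax  is an assumption occurrence, →I and ∨E discharge.

infix 2 _⊢_

data _⊢_ {At : Set} (Γ : List (Form At)) : Form At → Set where
  ax   : ∀ {A} → A ∈ Γ → Γ ⊢ A
  ∧I   : ∀ {A B} → Γ ⊢ A → Γ ⊢ B → Γ ⊢ A ∧ B
  ∧E₁  : ∀ {A B} → Γ ⊢ A ∧ B → Γ ⊢ A
  ∧E₂  : ∀ {A B} → Γ ⊢ A ∧ B → Γ ⊢ B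
  ∨I₁  : ∀ {A B} → Γ ⊢ A → Γ ⊢ A ∨ B
  ∨I₂  : ∀ {A B} → Γ ⊢ B → Γ ⊢ A ∨ B
  ∨E   : ∀ {A B C} → Γ ⊢ A ∨ B → A ∷ Γ ⊢ C → B ∷ Γ ⊢ C → Γ ⊢ C
  ⇒I   : ∀ {A B} → A ∷ Γ ⊢ B → Γ ⊢ A ⇒ B
  ⇒E   : ∀ {A B} → Γ ⊢ A ⇒ B → Γ ⊢ A → Γ ⊢ B
  efq  : ∀ {A} → Γ ⊢ ⊥' → Γ ⊢ A

module _ {At : Set} where

  -- height = max number of formula occurrences on a root-to-leaf branch
  height : ∀ {Γ : List (Form At)} {A} → Γ ⊢ A → ℕ
  height (ax _)    = 1
  height (∧I d e)  = suc (height d ⊔ height e)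
  height (∧E₁ d)   = suc (height d)
  height (∧E₂ d)   = suc (height d)
  height (∨I₁ d)   = suc (height d)
  height (∨I₂ d)   = suc (height d)
  height (∨E d e f) = suc (height d ⊔ height e ⊔ height f)
  height (⇒I d)    = suc (height d)
  height (⇒E d e)  = suc (height d ⊔ height e)
  height (efq d)   = suc (height d)

  introOrVE : ∀ {Γ : List (Form At)} {A} → Γ ⊢ A → Bool
  introOrVE (∧I _ _)   = true
  introOrVE (∨I₁ _)    = true
  introOrVE (∨I₂ _)    = true
  introOrVE (⇒I _)     = true
  introOrVE (∨E _ _ _) = true
  introOrVE _          = false

  -- normal: no formula occurrence is both the conclusion of an
  -- introduction or ∨E and the major premise of an elimination.
  Normal : ∀ {Γ : List (Form At)} {A} → Γ ⊢ A → Set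
  Normal (ax _)     = ⊤
  Normal (∧I d e)   = Normal d × Normal e
  Normal (∧E₁ d)    = introOrVE d ≡ false × Normal d
  Normal (∧E₂ d)    = introOrVE d ≡ false × Normal d
  Normal (∨I₁ d)    = Normal d
  Normal (∨I₂ d)    = Normal d
  Normal (∨E d e f) = introOrVE d ≡ false × Normal d × Normal e × Normal f
  Normal (⇒I d)     = Normal d
  Normal (⇒E d e)   = introOrVE d ≡ false × Normal d × Normal e
  Normal (efq d)    = Normal d

-- Polynomials with natural-number coefficients (c₀ ∷ c₁ ∷ … ).

Poly : Set
Poly = List ℕ

eval : Poly → ℕ → ℕ
eval []       x = 0
eval (c ∷ cs) x = c + x * eval cs x

module Submission where

open import Defs
open import Data.Nat using (ℕ; suc; _+_; _*_; _⊔_; _≤_; _<_; z≤n; s≤s)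
import Data.Nat as ℕ
open import Data.Nat.Properties
  using (≤-refl; ≤-trans; ≤-reflexive; n≤1+n; m≤m+n; m≤n+m; +-mono-≤; +-monoˡ-≤; +-monoʳ-≤;
         +-suc; +-assoc; ⊔-lub; ⊔-mono-≤; 1+n≰n)
open import Data.Nat.Tactic.RingSolver using (solve-∀)
open import Data.Fin using (Fin; toℕ; _≟_; punchOut)
open import Data.Fin.Properties using (any?; punchOut-injective; injective⇒≤)
open import Data.Bool using (true; false)
import Data.Bool as Bool
open import Data.Bool.Properties using (¬-not)
open import Data.List using (List; []; _∷_; map; length; allFin; filter; concatMap)
open import Data.List.Properties using (length-++; length-map; length-filter; length-tabulate)
open import Data.List.Membership.Propositional using (_∈_; _∉_)
open import Data.List.Membership.Propositional.Properties
  using (∈-map⁺; ∈-map⁻; ∈-filter⁺; ∈-filter⁻; ∈-concatMap⁺; ∈-concatMap⁻; ∈-allFin)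
open import Data.List.Relation.Binary.Subset.Propositional using (_⊆_)
open import Data.List.Relation.Binary.Subset.Propositional.Properties using (⊆-refl; xs⊆x∷xs; ∷⁺ʳ)
open import Data.List.Relation.Unary.Any as Any using (here; there; satisfied)
open import Data.Product using (Σ; _×_; _,_; proj₁; proj₂; map₂)
open import Data.Sum using (_⊎_; inj₁; inj₂)
open import Data.Unit using (tt)
open import Data.Empty using (⊥; ⊥-elim)
open import Relation.Nullary using (¬_; yes; no; ¬?)
open import Relation.Nullary.Decidable using (_×-dec_; decidable-stable)
open import Relation.Binary using (Rel; Decidable)
open import Relation.Binary.PropositionalEquality using (_≡_; _≢_; refl; sym; trans; cong; cong₂; subst)
open import Function.Bundles using (_⇔_; mk⇔; Bijection; mk⤖)
open import Function.Definitions using (Injective; Surjective)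

-- If G has a Hamiltonian path p, the valuation X_{i,v} := (p i ≡ v) makes α_G true, so by
-- soundness ¬α_G has no proof at all.  Conversely, assuming α_G we eliminate the disjunctions
-- of C for the positions 1, …, n in turn.  Each branch of the resulting tree fixes a map f from
-- positions to vertices, and as G is not Hamiltonian, either f is not injective (refuted by a
-- clause of B) or some step of f is not an edge (refuted by a clause of E').  All major premises
-- of eliminations are assumptions or projections of α_G, so the proof is normal, and each of
-- the n nested case analyses adds O(n) to the height, which is therefore O(n²).

module _ {At : Set} where

  wk : ∀ {Γ Δ : List (Form At)} {A} → Γ ⊆ Δ → Γ ⊢ A → Δ ⊢ A
  wk s (ax x)     = ax (s x)
  wk s (∧I d e)   = ∧I (wk s d) (wk s e)
  wk s (∧E₁ d)    = ∧E₁ (wk s d)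
  wk s (∧E₂ d)    = ∧E₂ (wk s d)
  wk s (∨I₁ d)    = ∨I₁ (wk s d)
  wk s (∨I₂ d)    = ∨I₂ (wk s d)
  wk s (∨E d e f) = ∨E (wk s d) (wk (∷⁺ʳ _ s) e) (wk (∷⁺ʳ _ s) f)
  wk s (⇒I d)     = ⇒I (wk (∷⁺ʳ _ s) d)
  wk s (⇒E d e)   = ⇒E (wk s d) (wk s e)
  wk s (efq d)    = efq (wk s d)

  height-wk : ∀ {Γ Δ : List (Form At)} {A} (s : Γ ⊆ Δ) (d : Γ ⊢ A) → height (wk s d) ≡ height d
  height-wk s (ax x)     = refl
  height-wk s (∧I d e)   = cong₂ (λ a b → suc (a ⊔ b)) (height-wk s d) (height-wk s e)
  height-wk s (∧E₁ d)    = cong suc (height-wk s d)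
  height-wk s (∧E₂ d)    = cong suc (height-wk s d)
  height-wk s (∨I₁ d)    = cong suc (height-wk s d)
  height-wk s (∨I₂ d)    = cong suc (height-wk s d)
  height-wk s (∨E d e f)
    rewrite height-wk s d | height-wk (∷⁺ʳ _ s) e | height-wk (∷⁺ʳ _ s) f = refl
  height-wk s (⇒I d)     = cong suc (height-wk (∷⁺ʳ _ s) d)
  height-wk s (⇒E d e)   = cong₂ (λ a b → suc (a ⊔ b)) (height-wk s d) (height-wk s e)
  height-wk s (efq d)    = cong suc (height-wk s d)

  introOrVE-wk : ∀ {Γ Δ : List (Form At)} {A} (s : Γ ⊆ Δ) (d : Γ ⊢ A) → introOrVE (wk s d) ≡ introOrVE d
  introOrVE-wk s (ax x)     = refl
  introOrVE-wk s (∧I d e)   = refl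
  introOrVE-wk s (∧E₁ d)    = refl
  introOrVE-wk s (∧E₂ d)    = refl
  introOrVE-wk s (∨I₁ d)    = refl
  introOrVE-wk s (∨I₂ d)    = refl
  introOrVE-wk s (∨E d e f) = refl
  introOrVE-wk s (⇒I d)     = refl
  introOrVE-wk s (⇒E d e)   = refl
  introOrVE-wk s (efq d)    = refl

  Normal-wk : ∀ {Γ Δ : List (Form At)} {A} (s : Γ ⊆ Δ) (d : Γ ⊢ A) → Normal d → Normal (wk s d)
  Normal-wk s (ax x)     n                 = n
  Normal-wk s (∧I d e)   (nd , ne)         = Normal-wk s d nd , Normal-wk s e ne
  Normal-wk s (∧E₁ d)    (io , nd)         = trans (introOrVE-wk s d) io , Normal-wk s d nd
  Normal-wk s (∧E₂ d)    (io , nd)         = trans (introOrVE-wk s d) io , Normal-wk s d nd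
  Normal-wk s (∨I₁ d)    nd                = Normal-wk s d nd
  Normal-wk s (∨I₂ d)    nd                = Normal-wk s d nd
  Normal-wk s (∨E d e f) (io , nd , ne , nf) =
    trans (introOrVE-wk s d) io , Normal-wk s d nd ,
    Normal-wk (∷⁺ʳ _ s) e ne , Normal-wk (∷⁺ʳ _ s) f nf
  Normal-wk s (⇒I d)     nd                = Normal-wk (∷⁺ʳ _ s) d nd
  Normal-wk s (⇒E d e)   (io , nd , ne)    =
    trans (introOrVE-wk s d) io , Normal-wk s d nd , Normal-wk s e ne
  Normal-wk s (efq d)    nd                = Normal-wk s d nd

  height-positive : ∀ {Γ : List (Form At)} {A} (d : Γ ⊢ A) → 1 ≤ height d
  height-positive (ax _)     = s≤s z≤n
  height-positive (∧I _ _)   = s≤s z≤n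
  height-positive (∧E₁ _)    = s≤s z≤n
  height-positive (∧E₂ _)    = s≤s z≤n
  height-positive (∨I₁ _)    = s≤s z≤n
  height-positive (∨I₂ _)    = s≤s z≤n
  height-positive (∨E _ _ _) = s≤s z≤n
  height-positive (⇒I _)     = s≤s z≤n
  height-positive (⇒E _ _)   = s≤s z≤n
  height-positive (efq _)    = s≤s z≤n

  BoundedNormal : List (Form At) → Form At → ℕ → Set
  BoundedNormal Γ A h = Σ (Γ ⊢ A) λ d → Normal d × height d ≤ h

  -- A normal derivation that may serve as the major premise of an elimination.
  record Neutral (Γ : List (Form At)) (A : Form At) (h : ℕ) : Set where
    constructor neutral
    field
      derivation : Γ ⊢ A
      elim-ended : introOrVE derivation ≡ false
      normal     : Normal derivation
      bounded    : height derivation ≤ h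

  Neutral-wk : ∀ {Γ Δ A h} → Γ ⊆ Δ → Neutral Γ A h → Neutral Δ A h
  Neutral-wk s (neutral d io nd hd) =
    neutral (wk s d) (trans (introOrVE-wk s d) io) (Normal-wk s d nd)
            (subst (_≤ _) (sym (height-wk s d)) hd)

  BoundedNormal-mono : ∀ {Γ A h h′} → h ≤ h′ → BoundedNormal Γ A h → BoundedNormal Γ A h′
  BoundedNormal-mono h≤h′ (d , nd , hd) = d , nd , ≤-trans hd h≤h′

  Neutral-assumption : ∀ {Γ A h} → 1 ≤ h → Neutral (A ∷ Γ) A h
  Neutral-assumption 1≤h = neutral (ax (here refl)) refl tt 1≤h

  ∨E-bounded : ∀ {Γ A B C h H₁ H₂} → Neutral Γ (A ∨ B) h →
               BoundedNormal (A ∷ Γ) C H₁ → BoundedNormal (B ∷ Γ) C H₂ →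
               BoundedNormal Γ C (suc (h ⊔ H₁ ⊔ H₂))
  ∨E-bounded (neutral d io nd hd) (e , ne , he) (f , nf , hf) =
    ∨E d e f , (io , nd , ne , nf) , s≤s (⊔-mono-≤ (⊔-mono-≤ hd he) hf)

  ⋀-elim : ∀ {B : Set} {Γ h} (g : B → Form At) {xs : List B} {x : B} →
           Neutral Γ (⋀ (map g xs)) h → x ∈ xs → Neutral Γ (g x) (length xs + h)
  ⋀-elim g {_ ∷ []} (neutral d io nd hd) (here refl) =
    neutral d io nd (≤-trans hd (n≤1+n _))
  ⋀-elim g {_ ∷ _ ∷ _} (neutral d io nd hd) (here refl) =
    neutral (∧E₁ d) refl (io , nd) (s≤s (≤-trans hd (m≤n+m _ _)))
  ⋀-elim g {_ ∷ y ∷ ys} {x} (neutral d io nd hd) (there x∈) =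
    subst (Neutral _ (g x)) (+-suc (length (y ∷ ys)) _)
          (⋀-elim g (neutral (∧E₂ d) refl (io , nd) (s≤s hd)) x∈)

  ⋁-elim : ∀ {B : Set} {Γ h C H} (g : B → Form At) {xs : List B} →
           Neutral Γ (⋁ (map g xs)) h →
           (∀ {Δ x} → Γ ⊆ Δ → x ∈ xs → Neutral Δ (g x) h → BoundedNormal Δ C H) →
           BoundedNormal Γ C (suc (length xs + h + H))
  ⋁-elim g {[]} (neutral d io nd hd) case = efq d , nd , s≤s (≤-trans hd (m≤m+n _ _))
  ⋁-elim {h = h} {H = H} g {_ ∷ []} d case =
    BoundedNormal-mono (≤-trans (m≤n+m H (suc h)) (n≤1+n _)) (case ⊆-refl (here refl) d)
  ⋁-elim {Γ = Γ} {h} {H = H} g {x ∷ y ∷ ys} d case =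
    BoundedNormal-mono (s≤s (⊔-lub (⊔-lub h≤bound H≤bound) ≤-refl))
      (∨E-bounded d (case (xs⊆x∷xs Γ _) (here refl) (Neutral-assumption 1≤h))
                    (⋁-elim g (Neutral-assumption 1≤h)
                              (λ s x∈ → case (λ z∈ → s (there z∈)) (there x∈))))
    where
      1≤h : 1 ≤ h
      1≤h = ≤-trans (height-positive (Neutral.derivation d)) (Neutral.bounded d)
      h≤bound : h ≤ suc (length (y ∷ ys) + h + H)
      h≤bound = ≤-trans (m≤n+m h _) (≤-trans (m≤m+n _ H) (n≤1+n _))
      H≤bound : H ≤ suc (length (y ∷ ys) + h + H)
      H≤bound = ≤-trans (m≤n+m H _) (n≤1+n _)

  ⇒-elim₂ : ∀ {Γ A B h k} → Neutral Γ (A ⇒ (B ⇒ ⊥')) h → Neutral Γ A k → Neutral Γ B k →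
            BoundedNormal Γ ⊥' (suc (suc (h + k)))
  ⇒-elim₂ {h = h} {k} (neutral d io nd hd) (neutral a _ na ha) (neutral b _ nb hb) =
    ⇒E (⇒E d a) b , (refl , (io , nd , na) , nb) ,
    s≤s (⊔-lub (s≤s (⊔-lub (≤-trans hd (m≤m+n h k)) (≤-trans ha (m≤n+m k h))))
               (≤-trans hb (≤-trans (m≤n+m k h) (n≤1+n _))))

module Semantics {At : Set} (ρ : At → Set) where

  ⟦_⟧ : Form At → Set
  ⟦ atom a ⟧ = ρ a
  ⟦ ⊥' ⟧     = ⊥
  ⟦ A ∧ B ⟧  = ⟦ A ⟧ × ⟦ B ⟧
  ⟦ A ∨ B ⟧  = ⟦ A ⟧ ⊎ ⟦ B ⟧
  ⟦ A ⇒ B ⟧  = ⟦ A ⟧ → ⟦ B ⟧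

  sound : ∀ {Γ A} → Γ ⊢ A → (∀ {B} → B ∈ Γ → ⟦ B ⟧) → ⟦ A ⟧
  sound (ax x)     η = η x
  sound (∧I d e)   η = sound d η , sound e η
  sound (∧E₁ d)    η = proj₁ (sound d η)
  sound (∧E₂ d)    η = proj₂ (sound d η)
  sound (∨I₁ d)    η = inj₁ (sound d η)
  sound (∨I₂ d)    η = inj₂ (sound d η)
  sound (∨E d e f) η with sound d η
  ... | inj₁ a = sound e λ { (here refl) → a ; (there p) → η p }
  ... | inj₂ b = sound f λ { (here refl) → b ; (there p) → η p }
  sound (⇒I d)     η = λ a → sound d λ { (here refl) → a ; (there p) → η p }
  sound (⇒E d e)   η = sound d η (sound e η)
  sound (efq d)    η = ⊥-elim (sound d η)

  ⋀-true : ∀ {B : Set} (g : B → Form At) (xs : List B) →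
           (∀ {x} → x ∈ xs → ⟦ g x ⟧) → ⟦ ⋀ (map g xs) ⟧
  ⋀-true g []           _    = λ ()
  ⋀-true g (x ∷ [])     holds = holds (here refl)
  ⋀-true g (x ∷ y ∷ ys) holds = holds (here refl) , ⋀-true g (y ∷ ys) (λ x∈ → holds (there x∈))

  ⋁-true : ∀ {B : Set} (g : B → Form At) {xs : List B} {x} → x ∈ xs → ⟦ g x ⟧ →
           ⟦ ⋁ (map g xs) ⟧
  ⋁-true g {_ ∷ []}    (here refl) a = a
  ⋁-true g {_ ∷ _ ∷ _} (here refl) a = inj₁ a
  ⋁-true g {_ ∷ _ ∷ _} (there x∈)  a = inj₂ (⋁-true g x∈ a)

module _ {A : Set} {ℓ} {R : Rel A ℓ} where

  pairsWhere : Decidable R → List A → List (A × A)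
  pairsWhere R? xs = concatMap (λ a → map (λ b → (a , b)) (filter (R? a) xs)) xs

  ∈-pairsWhere⁺ : ∀ (R? : Decidable R) xs {a b} → a ∈ xs → b ∈ xs → R a b →
                  (a , b) ∈ pairsWhere R? xs
  ∈-pairsWhere⁺ R? xs a∈ b∈ Rab =
    ∈-concatMap⁺ _ (Any.map (λ { refl → ∈-map⁺ _ (∈-filter⁺ (R? _) b∈ Rab) }) a∈)

  ∈-pairsWhere⁻ : ∀ (R? : Decidable R) xs {a b} → (a , b) ∈ pairsWhere R? xs → R a b
  ∈-pairsWhere⁻ R? xs ab∈
    with a , ab∈a ← satisfied (∈-concatMap⁻ (λ a → map (a ,_) (filter (R? a) xs)) {xs} ab∈)
    with _ , b∈ , refl ← ∈-map⁻ (a ,_) {xs = filter (R? a) xs} ab∈a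
    = proj₂ (∈-filter⁻ (R? a) {xs = xs} b∈)

  length-pairsWhere : ∀ (R? : Decidable R) xs → length (pairsWhere R? xs) ≤ length xs * length xs
  length-pairsWhere R? xs = go xs
    where
      row≤ : ∀ a → length (map (a ,_) (filter (R? a) xs)) ≤ length xs
      row≤ a = subst (_≤ length xs) (sym (length-map (a ,_) (filter (R? a) xs))) (length-filter (R? a) xs)
      go : ∀ ys → length (concatMap (λ a → map (a ,_) (filter (R? a) xs)) ys) ≤ length ys * length xs
      go []       = z≤n
      go (y ∷ ys) = subst (_≤ _) (sym (length-++ (map (y ,_) (filter (R? y) xs))))
                          (+-mono-≤ (row≤ y) (go ys))

injective⇒surjective : ∀ {n} (f : Fin n → Fin n) → Injective _≡_ _≡_ f → Surjective _≡_ _≡_ f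
injective⇒surjective {suc m} f f-inj y with any? (λ x → f x ≟ y)
... | yes (x , fx≡y) = x , λ { refl → fx≡y }
... | no y∉image = ⊥-elim (1+n≰n (injective⇒≤ g-inj))
  where
    -- f misses y, so it factors injectively through Fin m.
    g : Fin (suc m) → Fin m
    g x = punchOut {i = y} {j = f x} (λ y≡fx → y∉image (x , sym y≡fx))
    g-inj : Injective _≡_ _≡_ g
    g-inj {a} {b} ga≡gb =
      f-inj (punchOut-injective (λ e → y∉image (a , sym e)) (λ e → y∉image (b , sym e)) ga≡gb)

q : Poly
q = 15 ∷ 7 ∷ 5 ∷ []

quadratic-bound : ∀ {N} n {a b c} → N ≡ n → a ≤ N * N → b ≤ N * N → c ≤ N * N →
                  suc (N * suc (N + (N + 4)) + suc (suc ((a + (N + 3) + (b + (c + 5))) + (N + 4))))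
                    ≤ eval q n
quadratic-bound n refl a≤ b≤ c≤ =
  ≤-trans (s≤s (+-monoʳ-≤ (n * _) (s≤s (s≤s (+-monoˡ-≤ (n + 4)
             (+-mono-≤ (+-monoˡ-≤ (n + 3) a≤) (+-mono-≤ b≤ (+-monoˡ-≤ 5 c≤))))))))
          (≤-reflexive (polynomial n))
  where
    polynomial : ∀ n → suc (n * suc (n + (n + 4))
                            + suc (suc ((n * n + (n + 3) + (n * n + (n * n + 5))) + (n + 4))))
                       ≡ 15 + n * (7 + n * (5 + n * 0))
    polynomial = solve-∀

module _ {n : ℕ} (G : Digraph n) where

  ∈-distinctPairs : ∀ {i j : Fin n} → i ≢ j → (i , j) ∈ distinctPairs {n}
  ∈-distinctPairs = ∈-pairsWhere⁺ (λ a b → ¬? (a ≟ b)) (allFin n) (∈-allFin _) (∈-allFin _)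

  ∈-consecutive : ∀ {i j : Fin n} → toℕ j ≡ suc (toℕ i) → (i , j) ∈ consecutive {n}
  ∈-consecutive = ∈-pairsWhere⁺ (λ a b → toℕ b ℕ.≟ suc (toℕ a)) (allFin n) (∈-allFin _) (∈-allFin _)

  ∈-nonEdges : ∀ {v w} → adj G v w ≡ false → (v , w) ∈ nonEdges G
  ∈-nonEdges = ∈-pairsWhere⁺ (λ v w → adj G v w Bool.≟ false) (allFin n) (∈-allFin _) (∈-allFin _)

  data Defect (f : Fin n → Fin n) : Set where
    collision   : ∀ {i j} → i ≢ j → f i ≡ f j → Defect f
    missingEdge : ∀ {i j} → toℕ j ≡ suc (toℕ i) → adj G (f i) (f j) ≡ false → Defect f

  defect : ¬ Hamiltonian G → (f : Fin n → Fin n) → Defect f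
  defect ¬ham f with any? (λ i → any? (λ j → ¬? (i ≟ j) ×-dec (f i ≟ f j)))
  ... | yes (i , j , i≢j , fi≡fj) = collision i≢j fi≡fj
  ... | no ¬collision
    with any? (λ i → any? (λ j → (toℕ j ℕ.≟ suc (toℕ i)) ×-dec (adj G (f i) (f j) Bool.≟ false)))
  ...   | yes (i , j , step , nonEdge) = missingEdge step nonEdge
  ...   | no ¬missing = ⊥-elim (¬ham (mk⤖ (f-inj , injective⇒surjective f f-inj) , f-path))
    where
      f-inj : Injective _≡_ _≡_ f
      f-inj {x} {y} fx≡fy = decidable-stable (x ≟ y) (λ x≢y → ¬collision (x , y , x≢y , fx≡fy))
      f-path : ∀ i j → toℕ j ≡ suc (toℕ i) → adj G (f i) (f j) ≡ true
      f-path i j step = ¬-not (λ nonEdge → ¬missing (i , j , step , nonEdge))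

  pathValuation : Hamiltonian G → Atom n → Set
  pathValuation (p , _) (i , v) = Bijection.to p i ≡ v

  α-true : (h : Hamiltonian G) → Semantics.⟦_⟧ (pathValuation h) (α G)
  α-true h@(p , path) = A-true , B-true , C-true , D-true , E-true
    where
      open Bijection p
      open Semantics (pathValuation h)

      distinct : ∀ {a b} → (a , b) ∈ distinctPairs {n} → a ≢ b
      distinct = ∈-pairsWhere⁻ (λ a b → ¬? (a ≟ b)) (allFin n)

      A-true : ⟦ A-form {n} ⟧
      A-true = ⋀-true _ (allFin n) λ {v} _ →
        let (i , pi≡v) = surjective v in ⋁-true _ (∈-allFin i) (pi≡v refl)

      B-true : ⟦ B-form {n} ⟧
      B-true = ⋀-true _ (allFin n) λ _ → ⋀-true _ (distinctPairs {n}) λ { {i , j} ij∈ refl pj≡pi →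
        distinct ij∈ (injective (sym pj≡pi)) }

      C-true : ⟦ C-form {n} ⟧
      C-true = ⋀-true _ (allFin n) λ {i} _ → ⋁-true _ (∈-allFin (to i)) refl

      D-true : ⟦ D-form {n} ⟧
      D-true = ⋀-true _ (distinctPairs {n}) λ { {v , w} vw∈ → ⋀-true _ (allFin n) λ _ pi≡v pi≡w →
        distinct vw∈ (trans (sym pi≡v) pi≡w) }

      E-true : ⟦ E-form G ⟧
      E-true = ⋀-true _ (nonEdges G) λ { {v , w} vw∈ → ⋀-true _ (consecutive {n}) λ { {i , j} ij∈ refl refl →
        true≢false (trans (sym (path i j (∈-pairsWhere⁻ (λ a b → toℕ b ℕ.≟ suc (toℕ a)) (allFin n) ij∈)))
                          (∈-pairsWhere⁻ (λ v w → adj G v w Bool.≟ false) (allFin n) vw∈)) } }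
        where
          true≢false : true ≢ false
          true≢false ()

  hamiltonian⇒¬provable : Hamiltonian G → ¬ ([] ⊢ ~ α G)
  hamiltonian⇒¬provable h d = Semantics.sound _ d (λ ()) (α-true h)

  module Refutation (¬ham : ¬ Hamiltonian G) where

    -- hC, hB and hE bound the heights of the projections of clauses of C, B and E' out of the
    -- assumption α_G; each case analysis on a C-clause costs hStep.
    N hC hB hE hLeaf hStep : ℕ
    N     = length (allFin n)
    hC    = N + 4
    hB    = length (distinctPairs {n}) + (N + 3)
    hE    = length (consecutive {n}) + (length (nonEdges G) + 5)
    hLeaf = suc (suc ((hB + hE) + hC))
    hStep = suc (N + hC)

    module _ {Δ} (α∈ : α G ∈ Δ) where

      clauseC : (i : Fin n) → Neutral Δ (⋁ (map (λ v → X i v) (allFin n))) hC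
      clauseC i = ⋀-elim _ (neutral (∧E₁ (∧E₂ (∧E₂ (ax α∈)))) refl (refl , refl , refl , tt) ≤-refl)
                         (∈-allFin i)

      clauseB : ∀ {i j} → i ≢ j → (v : Fin n) → Neutral Δ (X i v ⇒ (X j v ⇒ ⊥')) hB
      clauseB i≢j v =
        ⋀-elim _ (⋀-elim _ (neutral (∧E₁ (∧E₂ (ax α∈))) refl (refl , refl , tt) ≤-refl)
                           (∈-allFin v))
                 (∈-distinctPairs i≢j)

      clauseE : ∀ {i j v w} → toℕ j ≡ suc (toℕ i) → adj G v w ≡ false →
                Neutral Δ (X i v ⇒ (X j w ⇒ ⊥')) hE
      clauseE step nonEdge =
        ⋀-elim _ (⋀-elim _ (neutral (∧E₂ (∧E₂ (∧E₂ (∧E₂ (ax α∈))))) refl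
                                    (refl , refl , refl , refl , tt) ≤-refl)
                           (∈-nonEdges nonEdge))
                 (∈-consecutive step)

      refuteAssignment : (f : Fin n → Fin n) → (∀ i → Neutral Δ (X i (f i)) hC) →
                         BoundedNormal Δ ⊥' hLeaf
      refuteAssignment f Xf with defect ¬ham f
      ... | collision {i} {j} i≢j fi≡fj =
        BoundedNormal-mono (s≤s (s≤s (+-monoˡ-≤ hC (m≤m+n hB hE))))
          (⇒-elim₂ (clauseB i≢j (f i)) (Xf i) (subst (λ w → Neutral Δ (X j w) hC) (sym fi≡fj) (Xf j)))
      ... | missingEdge {i} {j} step nonEdge =
        BoundedNormal-mono (s≤s (s≤s (+-monoˡ-≤ hC (m≤n+m hE hB))))
          (⇒-elim₂ (clauseE step nonEdge) (Xf i) (Xf j))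

    Assigned : List (Form (Atom n)) → List (Fin n) → Set
    Assigned Δ ps = ∀ i → i ∉ ps → Σ (Fin n) λ v → Neutral Δ (X i v) hC

    refuteAssignments : ∀ ps {Δ} → α G ∈ Δ → Assigned Δ ps →
                        BoundedNormal Δ ⊥' (length ps * hStep + hLeaf)
    refuteAssignments [] α∈ assigned =
      refuteAssignment α∈ (λ i → proj₁ (assigned i λ ())) (λ i → proj₂ (assigned i λ ()))
    refuteAssignments (p ∷ ps) {Δ} α∈ assigned =
      subst (BoundedNormal Δ ⊥') (sym (+-assoc hStep (length ps * hStep) hLeaf))
        (⋁-elim _ {allFin n} (clauseC α∈ p) λ s _ Xpv → refuteAssignments ps (s α∈) (extend s Xpv))
      where
        extend : ∀ {Δ′ v} → Δ ⊆ Δ′ → Neutral Δ′ (X p v) hC → Assigned Δ′ ps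
        extend {v = v} s Xpv i i∉ps with i ≟ p
        ... | yes refl = v , Xpv
        ... | no i≢p   = map₂ (Neutral-wk s)
                              (assigned i λ { (here i≡p) → i≢p i≡p ; (there i∈ps) → i∉ps i∈ps })

    refutation : BoundedNormal [] (~ α G) (suc (N * hStep + hLeaf))
    refutation
      with d , nd , hd ← refuteAssignments (allFin n) (here refl) (λ i i∉ → ⊥-elim (i∉ (∈-allFin i)))
      = ⇒I d , nd , s≤s hd

    height-refutation : suc (N * hStep + hLeaf) ≤ eval q n
    height-refutation = quadratic-bound n (length-tabulate _)
      (length-pairsWhere _ (allFin n)) (length-pairsWhere _ (allFin n)) (length-pairsWhere _ (allFin n))

  ¬hamiltonian⇒refutable : ¬ Hamiltonian G → BoundedNormal [] (~ α G) (eval q n)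
  ¬hamiltonian⇒refutable ¬ham = BoundedNormal-mono height-refutation refutation
    where open Refutation ¬ham

claim7 : Σ Poly λ q →
    ∀ (n : ℕ) → 0 < n → (G : Digraph n) →
    (¬ Hamiltonian G) ⇔
    Σ ([] ⊢ ~ α G) (λ d → Normal d × height d ≤ eval q n)
claim7 = q , λ n _ G → mk⇔ (¬hamiltonian⇒refutable G) (λ (d , _) ham → hamiltonian⇒¬provable G ham d)
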